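{- Let $u,v\in\mathbb{Z}[i]$ with $u+v\in O^I$, $uv\equiv0\pmod{1+i}$ and $\gcd(u,v)\in U$, and suppose the discriminant $(u+v)^2+4iuv$ of the quadratic equation $z^2-(u+v)z-iuv=0$ is a square in $\mathbb{Z}[i]$. Then there exist $x,y\in\mathbb{Z}[i]$ with $\gcd(x,y)\in U$ such that $x-y=u+v$ and $xy=iuv$.
   Context: $\mathbb{Z}[i]$ is the ring of Gaussian integers and $U=\{1,-1,i,-i\}$ its unit group. For $\alpha\in\mathbb{Z}[i]$, $R(\alpha)$ and $I(\alpha)$ denote its real and imaginary parts. $O^I=\{\alpha\in\mathbb{Z}[i]: R(\alpha)+I(\alpha)\equiv 1 \pmod 2,\ R(\alpha)\equiv 1 \pmod 4\}$. Congruences modulo $\mu$ mean divisibility by $\mu$ in $\mathbb{Z}[i]$; "$\gcd\in U$" means no common non-unit divisor. -}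

module Defs where

open import Data.Integer using (ℤ; +_; -[1+_]; _+_; _*_; -_; _-_)
open import Data.Product using (Σ; ∃; _×_; _,_)
open import Data.Sum using (_⊎_)
open import Relation.Binary.PropositionalEquality using (_≡_)

record ℤ[i] : Set where
  constructor _+_i
  field
    R : ℤ
    I : ℤ
open ℤ[i] public

infixl 6 _+ᵍ_ _-ᵍ_
infixl 7 _*ᵍ_

_+ᵍ_ : ℤ[i] → ℤ[i] → ℤ[i]
(a + b i) +ᵍ (c + d i) = (a + c) + (b + d) i

-ᵍ_ : ℤ[i] → ℤ[i]
-ᵍ (a + b i) = (- a) + (- b) i

_-ᵍ_ : ℤ[i] → ℤ[i] → ℤ[i]
x -ᵍ y = x +ᵍ (-ᵍ y)

_*ᵍ_ : ℤ[i] → ℤ[i] → ℤ[i]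
(a + b i) *ᵍ (c + d i) = (a * c - b * d) + (a * d + b * c) i

0ᵍ 1ᵍ iᵍ 4ᵍ 1+iᵍ : ℤ[i]
0ᵍ = (+ 0) + (+ 0) i
1ᵍ = (+ 1) + (+ 0) i
iᵍ = (+ 0) + (+ 1) i
4ᵍ = (+ 4) + (+ 0) i
1+iᵍ = (+ 1) + (+ 1) i

_∣ᵍ_ : ℤ[i] → ℤ[i] → Set
μ ∣ᵍ α = ∃ λ κ → α ≡ μ *ᵍ κ

_≡_[modᵍ_] : ℤ[i] → ℤ[i] → ℤ[i] → Set
α ≡ β [modᵍ μ ] = μ ∣ᵍ (α -ᵍ β)

_∈U : ℤ[i] → Set
α ∈U = (α ≡ 1ᵍ) ⊎ (α ≡ -ᵍ 1ᵍ) ⊎ (α ≡ iᵍ) ⊎ (α ≡ -ᵍ iᵍ)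

-- "gcd(α, β) ∈ U": every common divisor is a unit
GcdUnit : ℤ[i] → ℤ[i] → Set
GcdUnit α β = ∀ δ → δ ∣ᵍ α → δ ∣ᵍ β → δ ∈U

_∈Oᴵ : ℤ[i] → Set
α ∈Oᴵ = (∃ λ k → R α + I α ≡ + 1 + + 2 * k) × (∃ λ k → R α ≡ + 1 + + 4 * k)

IsSquare : ℤ[i] → Set
IsSquare α = ∃ λ w → α ≡ w *ᵍ w

-- Put s = u + v and P = iuv, and let w² = s² + 4P. Membership in Oᴵ gives s ≡ 1 (mod 2),
-- hence s² ≡ 1 and so w² ≡ 1 (mod 4); comparing real parts (c² − d² ≡ 1 mod 4 forces c odd, d even)
-- yields w ≡ 1 ≡ s (mod 2). Then x = (w + s)/2 and y = (w − s)/2 are Gaussian integers with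
-- x − y = s and xy = (w² − s²)/4 = P. A common divisor of x and y divides u + v = x − y and
-- uv = −i·xy. Since ℤ[i] is Euclidean, gcd(u, v) ∈ U gives au + bv = 1, whence
-- u = au(u + v) + (b − a)uv and v = bv(u + v) + (a − b)uv, so that divisor divides u and v and is a unit.

module Submission where

open import Defs
open import Level using (0ℓ)
open import Data.Nat as ℕ using (ℕ; suc; z≤n; s≤s)
import Data.Nat.Properties as ℕₚ
open import Data.Nat.Induction using (<-wellFounded)
import Data.Nat.Tactic.RingSolver as ℕ-Solver
open import Data.Integer as ℤ using (ℤ; +_; -[1+_]; _+_; _*_; -_; _-_; ∣_∣)
import Data.Integer.Properties as ℤₚ
open import Data.Integer.DivMod using (_%ℕ_; _/ℕ_; a≡a%ℕn+[a/ℕn]*n; n%ℕd<d)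
import Data.Integer.Tactic.RingSolver as ℤ-Solver
open import Data.List using ([]; _∷_)
open import Data.Maybe using (just; nothing)
open import Data.Product using (∃; _×_; _,_)
open import Data.Sum using (inj₁; inj₂)
open import Data.Empty using (⊥-elim)
open import Relation.Nullary using (yes; no; contradiction)
open import Relation.Binary.PropositionalEquality
open import Induction.WellFounded using (Acc; acc)
open import Algebra.Definitions {A = ℤ[i]} _≡_
open import Algebra.Consequences.Propositional {A = ℤ[i]}
  using (comm∧idˡ⇒idʳ; comm∧invˡ⇒inv; comm∧distrˡ⇒distrʳ)
open import Algebra.Structures {A = ℤ[i]} _≡_ using (IsCommutativeRing)
open import Algebra.Bundles using (CommutativeRing)
open import Tactic.RingSolver using (solve-∀; solve)
import Tactic.RingSolver.Core.AlmostCommutativeRing as ACR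

data Parity : ℤ → Set where
  even : ∀ h → Parity (+ 2 * h)
  odd  : ∀ h → Parity (+ 1 + + 2 * h)

parity : ∀ c → Parity c
parity c with c %ℕ 2 | n%ℕd<d c 2 | a≡a%ℕn+[a/ℕn]*n c 2
... | 0 | _ | c≡0+h2 =
  subst Parity (sym (trans c≡0+h2 (trans (ℤₚ.+-identityˡ _) (ℤₚ.*-comm (c /ℕ 2) (+ 2))))) (even (c /ℕ 2))
... | 1 | _ | c≡1+h2 =
  subst Parity (sym (trans c≡1+h2 (cong (λ z → + 1 + z) (ℤₚ.*-comm (c /ℕ 2) (+ 2))))) (odd (c /ℕ 2))
... | suc (suc _) | s≤s (s≤s ()) | _

odd≢even : ∀ k t → + 1 + + 2 * k ≢ + 2 * t
odd≢even k t eq = contradiction (ℕₚ.m*n≡1⇒m≡1 2 ∣ t - k ∣ 2∣t-k∣≡1) λ ()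
  where
  open ≡-Reasoning
  2[t-k]≡1 : + 2 * (t - k) ≡ + 1
  2[t-k]≡1 = begin
    + 2 * (t - k)              ≡⟨ ℤ-Solver.solve (k ∷ t ∷ []) ⟩
    + 2 * t - + 2 * k          ≡⟨ cong (_- + 2 * k) eq ⟨
    + 1 + + 2 * k - + 2 * k    ≡⟨ ℤ-Solver.solve (k ∷ []) ⟩
    + 1                        ∎
  2∣t-k∣≡1 : 2 ℕ.* ∣ t - k ∣ ≡ 1
  2∣t-k∣≡1 = trans (sym (ℤₚ.∣i*j∣≡∣i∣*∣j∣ (+ 2) (t - k))) (cong ∣_∣ 2[t-k]≡1)

1+4t≢2x : ∀ t x → + 1 + + 4 * t ≢ + 2 * x
1+4t≢2x t x eq = odd≢even (+ 2 * t) x (trans (cong (λ z → + 1 + z) (sym (ℤₚ.*-assoc (+ 2) (+ 2) t))) eq)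

1+4t≢4x-1 : ∀ t x → + 1 + + 4 * t ≢ + 4 * x - + 1
1+4t≢4x-1 t x eq = odd≢even t x (ℤₚ.*-cancelˡ-≡ (+ 2) _ _ (begin
  + 2 * (+ 1 + + 2 * t)     ≡⟨ ℤ-Solver.solve (t ∷ []) ⟩
  (+ 1 + + 4 * t) + + 1     ≡⟨ cong (_+ + 1) eq ⟩
  (+ 4 * x - + 1) + + 1     ≡⟨ ℤ-Solver.solve (x ∷ []) ⟩
  + 2 * (+ 2 * x)           ∎))
  where open ≡-Reasoning

c²-d²≡1+4t⇒odd-even : ∀ c d t → c * c - d * d ≡ + 1 + + 4 * t →
  (∃ λ h → c ≡ + 1 + + 2 * h) × (∃ λ h → d ≡ + 2 * h)
c²-d²≡1+4t⇒odd-even c d t eq with parity c | parity d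
... | odd h  | even h′ = (h , refl) , (h′ , refl)
... | even h | even h′ = ⊥-elim (1+4t≢2x t (+ 2 * (h * h - h′ * h′)) (trans (sym eq) (even²-even² h h′)))
  where
  even²-even² : ∀ h h′ → + 2 * h * (+ 2 * h) - + 2 * h′ * (+ 2 * h′) ≡ + 2 * (+ 2 * (h * h - h′ * h′))
  even²-even² = ℤ-Solver.solve-∀
... | odd h  | odd h′  = ⊥-elim (1+4t≢2x t (+ 2 * (h + h * h - h′ - h′ * h′)) (trans (sym eq) (odd²-odd² h h′)))
  where
  odd²-odd² : ∀ h h′ → (+ 1 + + 2 * h) * (+ 1 + + 2 * h) - (+ 1 + + 2 * h′) * (+ 1 + + 2 * h′)
                       ≡ + 2 * (+ 2 * (h + h * h - h′ - h′ * h′))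
  odd²-odd² = ℤ-Solver.solve-∀
... | even h | odd h′  = ⊥-elim (1+4t≢4x-1 t (h * h - h′ - h′ * h′) (trans (sym eq) (even²-odd² h h′)))
  where
  even²-odd² : ∀ h h′ → + 2 * h * (+ 2 * h) - (+ 1 + + 2 * h′) * (+ 1 + + 2 * h′)
                        ≡ + 4 * (h * h - h′ - h′ * h′) - + 1
  even²-odd² = ℤ-Solver.solve-∀

2[n∸r]≤n : ∀ {r n} → r ℕ.≤ n → n ℕ.≤ 2 ℕ.* r → 2 ℕ.* (n ℕ.∸ r) ℕ.≤ n
2[n∸r]≤n {r} {n} r≤n n≤2r = begin
  2 ℕ.* (n ℕ.∸ r)               ≡⟨ cong (n ℕ.∸ r ℕ.+_) (ℕₚ.+-identityʳ (n ℕ.∸ r)) ⟩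
  n ℕ.∸ r ℕ.+ (n ℕ.∸ r)         ≤⟨ ℕₚ.+-monoʳ-≤ (n ℕ.∸ r) n∸r≤r ⟩
  n ℕ.∸ r ℕ.+ r                 ≡⟨ ℕₚ.m∸n+n≡m r≤n ⟩
  n                             ∎
  where
  open ℕₚ.≤-Reasoning
  n∸r≤r : n ℕ.∸ r ℕ.≤ r
  n∸r≤r = ℕₚ.m≤n+o⇒m∸n≤o n r (subst (n ℕ.≤_) (cong (r ℕ.+_) (ℕₚ.+-identityʳ r)) n≤2r)

NearestQuotient : ℤ → ℕ → Set
NearestQuotient a n = ∃ λ q → ∃ λ r → (a ≡ q * + n + r) × (2 ℕ.* ∣ r ∣ ℕ.≤ n)

nearest-quotient : ∀ a n .{{_ : ℕ.NonZero n}} → NearestQuotient a n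
nearest-quotient a n with 2 ℕ.* (a %ℕ n) ℕ.≤? n
... | yes 2r≤n = a /ℕ n , + (a %ℕ n) , a≡qn+r , 2r≤n
  where
  a≡qn+r : a ≡ a /ℕ n * + n + + (a %ℕ n)
  a≡qn+r = trans (a≡a%ℕn+[a/ℕn]*n a n) (ℤₚ.+-comm (+ (a %ℕ n)) (a /ℕ n * + n))
... | no 2r≰n =
  a /ℕ n + + 1 , + (a %ℕ n) - + n , a≡qn+r , subst (λ k → 2 ℕ.* k ℕ.≤ n) (sym ∣r-n∣≡n∸r) 2[n∸r]≤n′
  where
  shift : ∀ r q n → r + q * n ≡ (q + + 1) * n + (r - n)
  shift = ℤ-Solver.solve-∀
  a≡qn+r : a ≡ (a /ℕ n + + 1) * + n + (+ (a %ℕ n) - + n)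
  a≡qn+r = trans (a≡a%ℕn+[a/ℕn]*n a n) (shift (+ (a %ℕ n)) (a /ℕ n) (+ n))
  ∣r-n∣≡n∸r : ∣ + (a %ℕ n) - + n ∣ ≡ n ℕ.∸ a %ℕ n
  ∣r-n∣≡n∸r = trans (cong ∣_∣ (ℤₚ.[+m]-[+n]≡m⊖n (a %ℕ n) n)) (ℤₚ.∣⊖∣-< (n%ℕd<d a n))
  2[n∸r]≤n′ : 2 ℕ.* (n ℕ.∸ a %ℕ n) ℕ.≤ n
  2[n∸r]≤n′ = 2[n∸r]≤n (ℕₚ.<⇒≤ (n%ℕd<d a n)) (ℕₚ.<⇒≤ (ℕₚ.≰⇒> 2r≰n))

m*n≡t₁²+t₂²⇒m<n : ∀ {m n t₁ t₂} → 0 ℕ.< n → m ℕ.* n ≡ t₁ ℕ.* t₁ ℕ.+ t₂ ℕ.* t₂ →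
  2 ℕ.* t₁ ℕ.≤ n → 2 ℕ.* t₂ ℕ.≤ n → m ℕ.< n
m*n≡t₁²+t₂²⇒m<n {m} {n} {t₁} {t₂} 0<n mn≡t₁²+t₂² 2t₁≤n 2t₂≤n =
  ℕₚ.*-cancelʳ-< 2 m n (ℕₚ.≤-<-trans 2m≤n (ℕₚ.m<m*n n 2 (s≤s (s≤s z≤n))))
  where
  instance
    n≢0 : ℕ.NonZero n
    n≢0 = ℕ.>-nonZero 0<n
  open ℕₚ.≤-Reasoning
  4mn≤2nn : m ℕ.* 2 ℕ.* n ℕ.* 2 ℕ.≤ n ℕ.* n ℕ.* 2
  4mn≤2nn = begin
    m ℕ.* 2 ℕ.* n ℕ.* 2                           ≡⟨ ℕ-Solver.solve (m ∷ n ∷ []) ⟩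
    4 ℕ.* (m ℕ.* n)                               ≡⟨ cong (4 ℕ.*_) mn≡t₁²+t₂² ⟩
    4 ℕ.* (t₁ ℕ.* t₁ ℕ.+ t₂ ℕ.* t₂)               ≡⟨ ℕ-Solver.solve (t₁ ∷ t₂ ∷ []) ⟩
    2 ℕ.* t₁ ℕ.* (2 ℕ.* t₁) ℕ.+ 2 ℕ.* t₂ ℕ.* (2 ℕ.* t₂)
      ≤⟨ ℕₚ.+-mono-≤ (ℕₚ.*-mono-≤ 2t₁≤n 2t₁≤n) (ℕₚ.*-mono-≤ 2t₂≤n 2t₂≤n) ⟩
    n ℕ.* n ℕ.+ n ℕ.* n                           ≡⟨ ℕ-Solver.solve (n ∷ []) ⟩
    n ℕ.* n ℕ.* 2                                 ∎
  2m≤n : m ℕ.* 2 ℕ.≤ n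
  2m≤n = ℕₚ.*-cancelʳ-≤ (m ℕ.* 2) n n (ℕₚ.*-cancelʳ-≤ (m ℕ.* 2 ℕ.* n) (n ℕ.* n) 2 4mn≤2nn)

≡ᵍ : {x y : ℤ[i]} → R x ≡ R y → I x ≡ I y → x ≡ y
≡ᵍ = cong₂ _+_i

+ᵍ-assoc : Associative _+ᵍ_
+ᵍ-assoc (a + b i) (c + d i) (e + f i) = ≡ᵍ (ℤₚ.+-assoc a c e) (ℤₚ.+-assoc b d f)

+ᵍ-comm : Commutative _+ᵍ_
+ᵍ-comm (a + b i) (c + d i) = ≡ᵍ (ℤₚ.+-comm a c) (ℤₚ.+-comm b d)

+ᵍ-identityˡ : LeftIdentity 0ᵍ _+ᵍ_
+ᵍ-identityˡ (a + b i) = ≡ᵍ (ℤₚ.+-identityˡ a) (ℤₚ.+-identityˡ b)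

+ᵍ-inverseˡ : LeftInverse 0ᵍ (λ z → -ᵍ z) _+ᵍ_
+ᵍ-inverseˡ (a + b i) = ≡ᵍ (ℤₚ.+-inverseˡ a) (ℤₚ.+-inverseˡ b)

*ᵍ-assoc : Associative _*ᵍ_
*ᵍ-assoc (a + b i) (c + d i) (e + f i) = ≡ᵍ (real a b c d e f) (imaginary a b c d e f)
  where
  real : ∀ a b c d e f → (a * c - b * d) * e - (a * d + b * c) * f ≡ a * (c * e - d * f) - b * (c * f + d * e)
  real = ℤ-Solver.solve-∀
  imaginary : ∀ a b c d e f → (a * c - b * d) * f + (a * d + b * c) * e ≡ a * (c * f + d * e) + b * (c * e - d * f)
  imaginary = ℤ-Solver.solve-∀

*ᵍ-comm : Commutative _*ᵍ_
*ᵍ-comm (a + b i) (c + d i) = ≡ᵍ (real a b c d) (imaginary a b c d)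
  where
  real : ∀ a b c d → a * c - b * d ≡ c * a - d * b
  real = ℤ-Solver.solve-∀
  imaginary : ∀ a b c d → a * d + b * c ≡ c * b + d * a
  imaginary = ℤ-Solver.solve-∀

*ᵍ-identityˡ : LeftIdentity 1ᵍ _*ᵍ_
*ᵍ-identityˡ (a + b i) = ≡ᵍ (real a b) (imaginary a b)
  where
  real : ∀ a b → + 1 * a - + 0 * b ≡ a
  real = ℤ-Solver.solve-∀
  imaginary : ∀ a b → + 1 * b + + 0 * a ≡ b
  imaginary = ℤ-Solver.solve-∀

*ᵍ-distribˡ-+ᵍ : _*ᵍ_ DistributesOverˡ _+ᵍ_
*ᵍ-distribˡ-+ᵍ (a + b i) (c + d i) (e + f i) = ≡ᵍ (real a b c d e f) (imaginary a b c d e f)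
  where
  real : ∀ a b c d e f → a * (c + e) - b * (d + f) ≡ (a * c - b * d) + (a * e - b * f)
  real = ℤ-Solver.solve-∀
  imaginary : ∀ a b c d e f → a * (d + f) + b * (c + e) ≡ (a * d + b * c) + (a * f + b * e)
  imaginary = ℤ-Solver.solve-∀

*ᵍ-identityʳ : RightIdentity 1ᵍ _*ᵍ_
*ᵍ-identityʳ = comm∧idˡ⇒idʳ *ᵍ-comm *ᵍ-identityˡ

ℤ[i]-isCommutativeRing : IsCommutativeRing _+ᵍ_ _*ᵍ_ (λ z → -ᵍ z) 0ᵍ 1ᵍ
ℤ[i]-isCommutativeRing = record
  { isRing = record
    { +-isAbelianGroup = record
      { isGroup = record
        { isMonoid = record
          { isSemigroup = record
            { isMagma = record { isEquivalence = isEquivalence ; ∙-cong = cong₂ _+ᵍ_ }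
            ; assoc = +ᵍ-assoc
            }
          ; identity = +ᵍ-identityˡ , comm∧idˡ⇒idʳ +ᵍ-comm +ᵍ-identityˡ
          }
        ; inverse = comm∧invˡ⇒inv +ᵍ-comm +ᵍ-inverseˡ
        ; ⁻¹-cong = cong (λ z → -ᵍ z)
        }
      ; comm = +ᵍ-comm
      }
    ; *-cong = cong₂ _*ᵍ_
    ; *-assoc = *ᵍ-assoc
    ; *-identity = *ᵍ-identityˡ , *ᵍ-identityʳ
    ; distrib = *ᵍ-distribˡ-+ᵍ , comm∧distrˡ⇒distrʳ *ᵍ-comm *ᵍ-distribˡ-+ᵍ
    }
  ; *-comm = *ᵍ-comm
  }

ℤ[i]-commutativeRing : CommutativeRing 0ℓ 0ℓ
ℤ[i]-commutativeRing = record { isCommutativeRing = ℤ[i]-isCommutativeRing }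

ℤ[i]-ring : ACR.AlmostCommutativeRing 0ℓ 0ℓ
ℤ[i]-ring = ACR.fromCommutativeRing ℤ[i]-commutativeRing λ
  { ((+ 0) + (+ 0) i) → just refl
  ; _ → nothing
  }

fromℤ : ℤ → ℤ[i]
fromℤ k = k + (+ 0) i

2ᵍ : ℤ[i]
2ᵍ = 1ᵍ +ᵍ 1ᵍ

fromℤ-*ᵍ-cancelˡ : ∀ k .{{_ : ℤ.NonZero k}} {x y} → fromℤ k *ᵍ x ≡ fromℤ k *ᵍ y → x ≡ y
fromℤ-*ᵍ-cancelˡ k {a + b i} {c + d i} eq =
  ≡ᵍ (ℤₚ.*-cancelˡ-≡ k a c (scaled-real a b c d (cong R eq)))
     (ℤₚ.*-cancelˡ-≡ k b d (scaled-imaginary a b c d (cong I eq)))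
  where
  scaled-real : ∀ a b c d → k * a - + 0 * b ≡ k * c - + 0 * d → k * a ≡ k * c
  scaled-real a b c d = subst₂ _≡_ (ℤ-Solver.solve (k ∷ a ∷ b ∷ [])) (ℤ-Solver.solve (k ∷ c ∷ d ∷ []))
  scaled-imaginary : ∀ a b c d → k * b + + 0 * a ≡ k * d + + 0 * c → k * b ≡ k * d
  scaled-imaginary a b c d = subst₂ _≡_ (ℤ-Solver.solve (k ∷ a ∷ b ∷ [])) (ℤ-Solver.solve (k ∷ c ∷ d ∷ []))

-- From here on ℤ[i]-valued arguments are supplied explicitly: an implicit one would have to be
-- recovered through _*ᵍ_ or _-ᵍ_ applied to an η-expanded meta, which unification cannot invert.
module _ {δ : ℤ[i]} where

  ∣ᵍ-multiple : ∀ c {x z} → δ ∣ᵍ x → z ≡ c *ᵍ x → δ ∣ᵍ z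
  ∣ᵍ-multiple c (κ , refl) refl = c *ᵍ κ , solve (δ ∷ c ∷ κ ∷ []) ℤ[i]-ring

  ∣ᵍ-combination : ∀ a b {x y z} → δ ∣ᵍ x → δ ∣ᵍ y → z ≡ a *ᵍ x +ᵍ b *ᵍ y → δ ∣ᵍ z
  ∣ᵍ-combination a b (κ , refl) (κ′ , refl) refl = a *ᵍ κ +ᵍ b *ᵍ κ′ , solve (δ ∷ a ∷ b ∷ κ ∷ κ′ ∷ []) ℤ[i]-ring

module _ (μ : ℤ[i]) where

  ≡-mod-sym : ∀ α β → α ≡ β [modᵍ μ ] → β ≡ α [modᵍ μ ]
  ≡-mod-sym α β α≡β = ∣ᵍ-multiple {μ} (-ᵍ 1ᵍ) α≡β (swap α β)
    where
    swap : ∀ α β → β -ᵍ α ≡ (-ᵍ 1ᵍ) *ᵍ (α -ᵍ β)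
    swap = solve-∀ ℤ[i]-ring

  ≡-mod-trans : ∀ α β γ → α ≡ β [modᵍ μ ] → β ≡ γ [modᵍ μ ] → α ≡ γ [modᵍ μ ]
  ≡-mod-trans α β γ α≡β β≡γ =
    ∣ᵍ-combination {μ} 1ᵍ 1ᵍ α≡β β≡γ (telescope α β γ)
    where
    telescope : ∀ α β γ → α -ᵍ γ ≡ 1ᵍ *ᵍ (α -ᵍ β) +ᵍ 1ᵍ *ᵍ (β -ᵍ γ)
    telescope = solve-∀ ℤ[i]-ring

square≡1-mod-4⇒≡1-mod-2 : ∀ w → (w *ᵍ w) ≡ 1ᵍ [modᵍ 4ᵍ ] → w ≡ 1ᵍ [modᵍ 2ᵍ ]
square≡1-mod-4⇒≡1-mod-2 (c + d i) (t + t′ i , w²-1≡4τ) = halve (c²-d²≡1+4t⇒odd-even c d t c²-d²≡1+4t)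
  where
  open ≡-Reasoning
  c²-d²≡1+4t : c * c - d * d ≡ + 1 + + 4 * t
  c²-d²≡1+4t = begin
    c * c - d * d                              ≡⟨ ℤ-Solver.solve (c ∷ d ∷ []) ⟩
    (c * c - d * d + - + 1) + + 1              ≡⟨ cong (_+ + 1) (cong R w²-1≡4τ) ⟩
    (+ 4 * t - + 0 * t′) + + 1                 ≡⟨ ℤ-Solver.solve (t ∷ t′ ∷ []) ⟩
    + 1 + + 4 * t                              ∎
  real : ∀ h h′ → (+ 1 + + 2 * h) + - + 1 ≡ + 2 * h - + 0 * h′
  real = ℤ-Solver.solve-∀
  imaginary : ∀ h h′ → + 2 * h′ + - + 0 ≡ + 2 * h′ + + 0 * h
  imaginary = ℤ-Solver.solve-∀
  halve : (∃ λ h → c ≡ + 1 + + 2 * h) × (∃ λ h → d ≡ + 2 * h) → (c + d i) ≡ 1ᵍ [modᵍ 2ᵍ ]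
  halve ((h , c≡1+2h) , (h′ , d≡2h′)) = h + h′ i ,
    ≡ᵍ (trans (cong (_+ - + 1) c≡1+2h) (real h h′)) (trans (cong (_+ - + 0) d≡2h′) (imaginary h h′))

≡1-mod-2⇒square≡1-mod-4 : ∀ s → s ≡ 1ᵍ [modᵍ 2ᵍ ] → (s *ᵍ s) ≡ 1ᵍ [modᵍ 4ᵍ ]
≡1-mod-2⇒square≡1-mod-4 s (σ , s-1≡2σ) = σ +ᵍ σ *ᵍ σ , (begin
  s *ᵍ s -ᵍ 1ᵍ                                      ≡⟨ complete-square s ⟩
  (s -ᵍ 1ᵍ) *ᵍ (s -ᵍ 1ᵍ) +ᵍ 2ᵍ *ᵍ (s -ᵍ 1ᵍ)          ≡⟨ cong (λ z → z *ᵍ z +ᵍ 2ᵍ *ᵍ z) s-1≡2σ ⟩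
  (2ᵍ *ᵍ σ) *ᵍ (2ᵍ *ᵍ σ) +ᵍ 2ᵍ *ᵍ (2ᵍ *ᵍ σ)          ≡⟨ factor σ ⟩
  4ᵍ *ᵍ (σ +ᵍ σ *ᵍ σ)                               ∎)
  where
  open ≡-Reasoning
  complete-square : ∀ s → s *ᵍ s -ᵍ 1ᵍ ≡ (s -ᵍ 1ᵍ) *ᵍ (s -ᵍ 1ᵍ) +ᵍ 2ᵍ *ᵍ (s -ᵍ 1ᵍ)
  complete-square = solve-∀ ℤ[i]-ring
  factor : ∀ σ → (2ᵍ *ᵍ σ) *ᵍ (2ᵍ *ᵍ σ) +ᵍ 2ᵍ *ᵍ (2ᵍ *ᵍ σ) ≡ 4ᵍ *ᵍ (σ +ᵍ σ *ᵍ σ)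
  factor = solve-∀ ℤ[i]-ring

Oᴵ⇒≡1-mod-2 : ∀ {s} → s ∈Oᴵ → s ≡ 1ᵍ [modᵍ 2ᵍ ]
Oᴵ⇒≡1-mod-2 {_ + b i} ((m , a+b≡1+2m) , (k , refl)) =
  (+ 2 * k) + (m - + 2 * k) i , ≡ᵍ (real k (m - + 2 * k)) imaginary
  where
  open ≡-Reasoning
  real : ∀ k j → (+ 1 + + 4 * k) + - + 1 ≡ + 2 * (+ 2 * k) - + 0 * j
  real = ℤ-Solver.solve-∀
  imaginary : b + - + 0 ≡ + 2 * (m - + 2 * k) + + 0 * (+ 2 * k)
  imaginary = begin
    b + - + 0                                   ≡⟨ ℤ-Solver.solve (b ∷ k ∷ []) ⟩
    ((+ 1 + + 4 * k) + b) - (+ 1 + + 4 * k)     ≡⟨ cong (_- (+ 1 + + 4 * k)) a+b≡1+2m ⟩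
    (+ 1 + + 2 * m) - (+ 1 + + 4 * k)           ≡⟨ ℤ-Solver.solve (k ∷ m ∷ []) ⟩
    + 2 * (m - + 2 * k) + + 0 * (+ 2 * k)       ∎

Roots : ℤ[i] → ℤ[i] → Set
Roots s P = ∃ λ x → ∃ λ y → (x -ᵍ y ≡ s) × (x *ᵍ y ≡ P)

roots-of-congruent-square : ∀ s w P → w ≡ s [modᵍ 2ᵍ ] → w *ᵍ w -ᵍ s *ᵍ s ≡ 4ᵍ *ᵍ P → Roots s P
roots-of-congruent-square s w P (y , w-s≡2y) w²-s²≡4P =
  s +ᵍ y , y , difference s y , fromℤ-*ᵍ-cancelˡ (+ 4) (begin
  4ᵍ *ᵍ ((s +ᵍ y) *ᵍ y)                              ≡⟨ expand s y ⟩
  (2ᵍ *ᵍ y) *ᵍ (2ᵍ *ᵍ y) +ᵍ 2ᵍ *ᵍ s *ᵍ (2ᵍ *ᵍ y)      ≡⟨ cong (λ z → z *ᵍ z +ᵍ 2ᵍ *ᵍ s *ᵍ z) w-s≡2y ⟨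
  (w -ᵍ s) *ᵍ (w -ᵍ s) +ᵍ 2ᵍ *ᵍ s *ᵍ (w -ᵍ s)         ≡⟨ difference-of-squares w s ⟩
  w *ᵍ w -ᵍ s *ᵍ s                                   ≡⟨ w²-s²≡4P ⟩
  4ᵍ *ᵍ P                                            ∎)
  where
  open ≡-Reasoning
  difference : ∀ s y → s +ᵍ y -ᵍ y ≡ s
  difference = solve-∀ ℤ[i]-ring
  expand : ∀ s y → 4ᵍ *ᵍ ((s +ᵍ y) *ᵍ y) ≡ (2ᵍ *ᵍ y) *ᵍ (2ᵍ *ᵍ y) +ᵍ 2ᵍ *ᵍ s *ᵍ (2ᵍ *ᵍ y)
  expand = solve-∀ ℤ[i]-ring
  difference-of-squares : ∀ w s → (w -ᵍ s) *ᵍ (w -ᵍ s) +ᵍ 2ᵍ *ᵍ s *ᵍ (w -ᵍ s) ≡ w *ᵍ w -ᵍ s *ᵍ s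
  difference-of-squares = solve-∀ ℤ[i]-ring

roots-of-odd-quadratic : ∀ s w P → s ≡ 1ᵍ [modᵍ 2ᵍ ] → w *ᵍ w ≡ s *ᵍ s +ᵍ 4ᵍ *ᵍ P → Roots s P
roots-of-odd-quadratic s w P s≡1 w²≡s²+4P = roots-of-congruent-square s w P w≡s w²-s²≡4P
  where
  cancel : ∀ s P → s *ᵍ s +ᵍ 4ᵍ *ᵍ P -ᵍ s *ᵍ s ≡ 4ᵍ *ᵍ P
  cancel = solve-∀ ℤ[i]-ring
  w²-s²≡4P : w *ᵍ w -ᵍ s *ᵍ s ≡ 4ᵍ *ᵍ P
  w²-s²≡4P = trans (cong (_-ᵍ s *ᵍ s) w²≡s²+4P) (cancel s P)
  w²≡s² : (w *ᵍ w) ≡ s *ᵍ s [modᵍ 4ᵍ ]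
  w²≡s² = P , w²-s²≡4P
  w≡1 : w ≡ 1ᵍ [modᵍ 2ᵍ ]
  w≡1 = square≡1-mod-4⇒≡1-mod-2 w (≡-mod-trans 4ᵍ (w *ᵍ w) (s *ᵍ s) 1ᵍ w²≡s² (≡1-mod-2⇒square≡1-mod-4 s s≡1))
  w≡s : w ≡ s [modᵍ 2ᵍ ]
  w≡s = ≡-mod-trans 2ᵍ w 1ᵍ s w≡1 (≡-mod-sym 2ᵍ s 1ᵍ s≡1)

N : ℤ[i] → ℕ
N (a + b i) = ∣ a ∣ ℕ.* ∣ a ∣ ℕ.+ ∣ b ∣ ℕ.* ∣ b ∣

conj : ℤ[i] → ℤ[i]
conj (a + b i) = a + (- b) i

+∣a∣*∣a∣≡a*a : ∀ a → + (∣ a ∣ ℕ.* ∣ a ∣) ≡ a * a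
+∣a∣*∣a∣≡a*a (+ n)    = ℤₚ.pos-* n n
+∣a∣*∣a∣≡a*a -[1+ n ] = refl

+N≡ : ∀ z → + N z ≡ R z * R z + I z * I z
+N≡ (a + b i) = trans (ℤₚ.pos-+ (∣ a ∣ ℕ.* ∣ a ∣) (∣ b ∣ ℕ.* ∣ b ∣)) (cong₂ _+_ (+∣a∣*∣a∣≡a*a a) (+∣a∣*∣a∣≡a*a b))

N-*ᵍ : ∀ x y → N (x *ᵍ y) ≡ N x ℕ.* N y
N-*ᵍ x@(a + b i) y@(c + d i) = ℤₚ.+-injective (begin
  + N (x *ᵍ y)                                                          ≡⟨ +N≡ (x *ᵍ y) ⟩
  (a * c - b * d) * (a * c - b * d) + (a * d + b * c) * (a * d + b * c) ≡⟨ brahmagupta a b c d ⟩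
  (a * a + b * b) * (c * c + d * d)                                     ≡⟨ cong₂ _*_ (+N≡ x) (+N≡ y) ⟨
  + N x * + N y                                                         ≡⟨ ℤₚ.pos-* (N x) (N y) ⟨
  + (N x ℕ.* N y)                                                       ∎)
  where
  open ≡-Reasoning
  brahmagupta : ∀ a b c d → (a * c - b * d) * (a * c - b * d) + (a * d + b * c) * (a * d + b * c)
                            ≡ (a * a + b * b) * (c * c + d * d)
  brahmagupta = ℤ-Solver.solve-∀

N-conj : ∀ z → N (conj z) ≡ N z
N-conj (a + b i) = cong (λ k → ∣ a ∣ ℕ.* ∣ a ∣ ℕ.+ k ℕ.* k) (ℤₚ.∣-i∣≡∣i∣ b)

*ᵍ-conj : ∀ z → z *ᵍ conj z ≡ fromℤ (+ N z)
*ᵍ-conj z@(a + b i) = ≡ᵍ (trans (real a b) (sym (+N≡ z))) (imaginary a b)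
  where
  real : ∀ a b → a * a - b * - b ≡ a * a + b * b
  real = ℤ-Solver.solve-∀
  imaginary : ∀ a b → a * - b + b * a ≡ + 0
  imaginary = ℤ-Solver.solve-∀

N≡0⇒≡0ᵍ : ∀ z → N z ≡ 0 → z ≡ 0ᵍ
N≡0⇒≡0ᵍ (a + b i) Nz≡0 =
  ≡ᵍ (square≡0 a (ℕₚ.m+n≡0⇒m≡0 _ Nz≡0)) (square≡0 b (ℕₚ.m+n≡0⇒n≡0 (∣ a ∣ ℕ.* ∣ a ∣) Nz≡0))
  where
  square≡0 : ∀ c → ∣ c ∣ ℕ.* ∣ c ∣ ≡ 0 → c ≡ + 0
  square≡0 c eq with ℕₚ.m*n≡0⇒m≡0∨n≡0 ∣ c ∣ eq
  ... | inj₁ ∣c∣≡0 = ℤₚ.∣i∣≡0⇒i≡0 ∣c∣≡0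
  ... | inj₂ ∣c∣≡0 = ℤₚ.∣i∣≡0⇒i≡0 ∣c∣≡0

euclidean-division : ∀ α β → 0 ℕ.< N β → ∃ λ q → N (α -ᵍ q *ᵍ β) ℕ.< N β
euclidean-division α β 0<Nβ = divide (nearest-quotient (R γ) n) (nearest-quotient (I γ) n)
  where
  n : ℕ
  n = N β
  instance
    n≢0 : ℕ.NonZero n
    n≢0 = ℕ.>-nonZero 0<Nβ
  γ : ℤ[i]
  γ = α *ᵍ conj β
  divide : NearestQuotient (R γ) n → NearestQuotient (I γ) n → ∃ λ q → N (α -ᵍ q *ᵍ β) ℕ.< n
  divide (q₁ , r₁ , γ₁≡q₁n+r₁ , 2r₁≤n) (q₂ , r₂ , γ₂≡q₂n+r₂ , 2r₂≤n) =
    q , m*n≡t₁²+t₂²⇒m<n {t₁ = ∣ r₁ ∣} {∣ r₂ ∣} 0<Nβ Nρ·n≡Nr 2r₁≤n 2r₂≤n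
    where
    open ≡-Reasoning
    q r ρ : ℤ[i]
    q = q₁ + q₂ i
    r = r₁ + r₂ i
    ρ = α -ᵍ q *ᵍ β
    real : ∀ q₁ q₂ n r₁ → q₁ * n + r₁ ≡ q₁ * n - q₂ * + 0 + r₁
    real = ℤ-Solver.solve-∀
    imaginary : ∀ q₁ q₂ n r₂ → q₂ * n + r₂ ≡ q₁ * + 0 + q₂ * n + r₂
    imaginary = ℤ-Solver.solve-∀
    γ≡qn+r : γ ≡ q *ᵍ fromℤ (+ n) +ᵍ r
    γ≡qn+r = ≡ᵍ (trans γ₁≡q₁n+r₁ (real q₁ q₂ (+ n) r₁)) (trans γ₂≡q₂n+r₂ (imaginary q₁ q₂ (+ n) r₂))
    distribute : ∀ α q β c → (α -ᵍ q *ᵍ β) *ᵍ c ≡ α *ᵍ c -ᵍ q *ᵍ (β *ᵍ c)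
    distribute = solve-∀ ℤ[i]-ring
    cancel : ∀ q m r → q *ᵍ m +ᵍ r -ᵍ q *ᵍ m ≡ r
    cancel = solve-∀ ℤ[i]-ring
    ρ·conjβ≡r : ρ *ᵍ conj β ≡ r
    ρ·conjβ≡r = begin
      ρ *ᵍ conj β                                   ≡⟨ distribute α q β (conj β) ⟩
      γ -ᵍ q *ᵍ (β *ᵍ conj β)                       ≡⟨ cong₂ (λ x y → x -ᵍ q *ᵍ y) γ≡qn+r (*ᵍ-conj β) ⟩
      q *ᵍ fromℤ (+ n) +ᵍ r -ᵍ q *ᵍ fromℤ (+ n)     ≡⟨ cancel q (fromℤ (+ n)) r ⟩
      r                                             ∎
    Nρ·n≡Nr : N ρ ℕ.* n ≡ ∣ r₁ ∣ ℕ.* ∣ r₁ ∣ ℕ.+ ∣ r₂ ∣ ℕ.* ∣ r₂ ∣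
    Nρ·n≡Nr = begin
      N ρ ℕ.* n             ≡⟨ cong (N ρ ℕ.*_) (N-conj β) ⟨
      N ρ ℕ.* N (conj β)    ≡⟨ N-*ᵍ ρ (conj β) ⟨
      N (ρ *ᵍ conj β)       ≡⟨ cong N ρ·conjβ≡r ⟩
      N r                   ∎

record Bézout (α β : ℤ[i]) : Set where
  constructor bézout
  field
    gcd a b : ℤ[i]
    gcd∣α   : gcd ∣ᵍ α
    gcd∣β   : gcd ∣ᵍ β
    gcd≡    : gcd ≡ a *ᵍ α +ᵍ b *ᵍ β

Bézout-zero : ∀ α → Bézout α 0ᵍ
Bézout-zero α = bézout α 1ᵍ 0ᵍ (1ᵍ , sym (*ᵍ-identityʳ α)) (0ᵍ , *-0 α) (combination α)
  where
  *-0 : ∀ α → 0ᵍ ≡ α *ᵍ 0ᵍ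
  *-0 = solve-∀ ℤ[i]-ring
  combination : ∀ α → α ≡ 1ᵍ *ᵍ α +ᵍ 0ᵍ *ᵍ 0ᵍ
  combination = solve-∀ ℤ[i]-ring

Bézout-step : ∀ α β q → Bézout β (α -ᵍ q *ᵍ β) → Bézout α β
Bézout-step α β q (bézout g a b g∣β g∣ρ g≡aβ+bρ) =
  bézout g b (a -ᵍ b *ᵍ q) (∣ᵍ-combination {g} 1ᵍ q g∣ρ g∣β (α≡ρ+qβ α β q)) g∣β (trans g≡aβ+bρ (regroup α β q a b))
  where
  α≡ρ+qβ : ∀ α β q → α ≡ 1ᵍ *ᵍ (α -ᵍ q *ᵍ β) +ᵍ q *ᵍ β
  α≡ρ+qβ = solve-∀ ℤ[i]-ring
  regroup : ∀ α β q a b → a *ᵍ β +ᵍ b *ᵍ (α -ᵍ q *ᵍ β) ≡ b *ᵍ α +ᵍ (a -ᵍ b *ᵍ q) *ᵍ β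
  regroup = solve-∀ ℤ[i]-ring

bézout-identity : ∀ α β → Bézout α β
bézout-identity α β = go α β (<-wellFounded (N β))
  where
  go : ∀ α β → Acc ℕ._<_ (N β) → Bézout α β
  go α β (acc rec) with N β ℕ.≟ 0
  ... | yes Nβ≡0 = subst (Bézout α) (sym (N≡0⇒≡0ᵍ β Nβ≡0)) (Bézout-zero α)
  ... | no Nβ≢0 =
    let q , Nρ<Nβ = euclidean-division α β (ℕₚ.n≢0⇒n>0 Nβ≢0)
    in Bézout-step α β q (go β (α -ᵍ q *ᵍ β) (rec Nρ<Nβ))

unit-inverse : ∀ ε → ε ∈U → ∃ λ ε⁻¹ → ε⁻¹ *ᵍ ε ≡ 1ᵍ
unit-inverse _ (inj₁ refl)                 = 1ᵍ , refl
unit-inverse _ (inj₂ (inj₁ refl))          = -ᵍ 1ᵍ , refl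
unit-inverse _ (inj₂ (inj₂ (inj₁ refl)))   = -ᵍ iᵍ , refl
unit-inverse _ (inj₂ (inj₂ (inj₂ refl)))   = iᵍ , refl

GcdUnit⇒1≡combination : ∀ u v → GcdUnit u v → ∃ λ a → ∃ λ b → 1ᵍ ≡ a *ᵍ u +ᵍ b *ᵍ v
GcdUnit⇒1≡combination u v coprime = scale (unit-inverse gcd (coprime gcd gcd∣α gcd∣β))
  where
  open Bézout (bézout-identity u v)
  distribute : ∀ e a b u v → e *ᵍ (a *ᵍ u +ᵍ b *ᵍ v) ≡ e *ᵍ a *ᵍ u +ᵍ e *ᵍ b *ᵍ v
  distribute = solve-∀ ℤ[i]-ring
  scale : (∃ λ ε⁻¹ → ε⁻¹ *ᵍ gcd ≡ 1ᵍ) → ∃ λ a → ∃ λ b → 1ᵍ ≡ a *ᵍ u +ᵍ b *ᵍ v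
  scale (ε⁻¹ , ε⁻¹·gcd≡1) = ε⁻¹ *ᵍ a , ε⁻¹ *ᵍ b , (begin
    1ᵍ                              ≡⟨ ε⁻¹·gcd≡1 ⟨
    ε⁻¹ *ᵍ gcd                      ≡⟨ cong (ε⁻¹ *ᵍ_) gcd≡ ⟩
    ε⁻¹ *ᵍ (a *ᵍ u +ᵍ b *ᵍ v)       ≡⟨ distribute ε⁻¹ a b u v ⟩
    ε⁻¹ *ᵍ a *ᵍ u +ᵍ ε⁻¹ *ᵍ b *ᵍ v  ∎)
    where open ≡-Reasoning

GcdUnit-+-* : ∀ u v → GcdUnit u v → GcdUnit (u +ᵍ v) (u *ᵍ v)
GcdUnit-+-* u v coprime = common-divisors (GcdUnit⇒1≡combination u v coprime)
  where
  open ≡-Reasoning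
  u-cofactors : ∀ a b u v → u *ᵍ (a *ᵍ u +ᵍ b *ᵍ v) ≡ (a *ᵍ u) *ᵍ (u +ᵍ v) +ᵍ (b -ᵍ a) *ᵍ (u *ᵍ v)
  u-cofactors = solve-∀ ℤ[i]-ring
  v-cofactors : ∀ a b u v → v *ᵍ (a *ᵍ u +ᵍ b *ᵍ v) ≡ (b *ᵍ v) *ᵍ (u +ᵍ v) +ᵍ (a -ᵍ b) *ᵍ (u *ᵍ v)
  v-cofactors = solve-∀ ℤ[i]-ring
  common-divisors : (∃ λ a → ∃ λ b → 1ᵍ ≡ a *ᵍ u +ᵍ b *ᵍ v) → GcdUnit (u +ᵍ v) (u *ᵍ v)
  common-divisors (a , b , 1≡au+bv) δ δ∣u+v δ∣uv = coprime δ δ∣u δ∣v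
    where
    δ∣u : δ ∣ᵍ u
    δ∣u = ∣ᵍ-combination {δ} (a *ᵍ u) (b -ᵍ a) δ∣u+v δ∣uv (begin
      u                                              ≡⟨ *ᵍ-identityʳ u ⟨
      u *ᵍ 1ᵍ                                        ≡⟨ cong (u *ᵍ_) 1≡au+bv ⟩
      u *ᵍ (a *ᵍ u +ᵍ b *ᵍ v)                        ≡⟨ u-cofactors a b u v ⟩
      (a *ᵍ u) *ᵍ (u +ᵍ v) +ᵍ (b -ᵍ a) *ᵍ (u *ᵍ v)   ∎)
    δ∣v : δ ∣ᵍ v
    δ∣v = ∣ᵍ-combination {δ} (b *ᵍ v) (a -ᵍ b) δ∣u+v δ∣uv (begin
      v                                              ≡⟨ *ᵍ-identityʳ v ⟨
      v *ᵍ 1ᵍ                                        ≡⟨ cong (v *ᵍ_) 1≡au+bv ⟩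
      v *ᵍ (a *ᵍ u +ᵍ b *ᵍ v)                        ≡⟨ v-cofactors a b u v ⟩
      (b *ᵍ v) *ᵍ (u +ᵍ v) +ᵍ (a -ᵍ b) *ᵍ (u *ᵍ v)   ∎)

GcdUnit-roots : ∀ u v x y → GcdUnit u v → x -ᵍ y ≡ u +ᵍ v → x *ᵍ y ≡ iᵍ *ᵍ u *ᵍ v → GcdUnit x y
GcdUnit-roots u v x y coprime x-y≡u+v xy≡iuv δ δ∣x δ∣y =
  GcdUnit-+-* u v coprime δ
    (∣ᵍ-combination {δ} 1ᵍ (-ᵍ 1ᵍ) δ∣x δ∣y (trans (sym x-y≡u+v) (difference x y)))
    (∣ᵍ-multiple {δ} ((-ᵍ iᵍ) *ᵍ x) δ∣y (begin
      u *ᵍ v                         ≡⟨ rotate-back u v ⟩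
      (-ᵍ iᵍ) *ᵍ (iᵍ *ᵍ u *ᵍ v)      ≡⟨ cong ((-ᵍ iᵍ) *ᵍ_) xy≡iuv ⟨
      (-ᵍ iᵍ) *ᵍ (x *ᵍ y)            ≡⟨ *ᵍ-assoc (-ᵍ iᵍ) x y ⟨
      (-ᵍ iᵍ) *ᵍ x *ᵍ y              ∎))
  where
  open ≡-Reasoning
  difference : ∀ x y → x -ᵍ y ≡ 1ᵍ *ᵍ x +ᵍ (-ᵍ 1ᵍ) *ᵍ y
  difference = solve-∀ ℤ[i]-ring
  rotate-back : ∀ u v → u *ᵍ v ≡ (-ᵍ iᵍ) *ᵍ (iᵍ *ᵍ u *ᵍ v)
  rotate-back = solve-∀ ℤ[i]-ring

corollary4p22 : (u v : ℤ[i]) →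
    (u +ᵍ v) ∈Oᴵ →
    (u *ᵍ v) ≡ 0ᵍ [modᵍ 1+iᵍ ] →
    GcdUnit u v →
    IsSquare ((u +ᵍ v) *ᵍ (u +ᵍ v) +ᵍ 4ᵍ *ᵍ iᵍ *ᵍ u *ᵍ v) →
    ∃ λ x → ∃ λ y → GcdUnit x y × (x -ᵍ y ≡ u +ᵍ v) × (x *ᵍ y ≡ iᵍ *ᵍ u *ᵍ v)
corollary4p22 u v u+v∈Oᴵ _ coprime (w , disc≡w²) = coprime-roots roots
  where
  reassociate : ∀ s f ι u v → s +ᵍ f *ᵍ ι *ᵍ u *ᵍ v ≡ s +ᵍ f *ᵍ (ι *ᵍ u *ᵍ v)
  reassociate = solve-∀ ℤ[i]-ring
  roots : Roots (u +ᵍ v) (iᵍ *ᵍ u *ᵍ v)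
  roots = roots-of-odd-quadratic (u +ᵍ v) w (iᵍ *ᵍ u *ᵍ v) (Oᴵ⇒≡1-mod-2 u+v∈Oᴵ)
    (trans (sym disc≡w²) (reassociate ((u +ᵍ v) *ᵍ (u +ᵍ v)) 4ᵍ iᵍ u v))
  coprime-roots : Roots (u +ᵍ v) (iᵍ *ᵍ u *ᵍ v) →
    ∃ λ x → ∃ λ y → GcdUnit x y × (x -ᵍ y ≡ u +ᵍ v) × (x *ᵍ y ≡ iᵍ *ᵍ u *ᵍ v)
  coprime-roots (x , y , x-y≡u+v , xy≡iuv) = x , y , GcdUnit-roots u v x y coprime x-y≡u+v xy≡iuv , x-y≡u+v , xy≡iuv
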